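{- Let $G$ be a digraph, $b\in V(G)$ and $I\subseteq V(G)\setminus\{b\}$ such that $G$ is exact for $b$ and $I$ and every finite subset of $I$ has a linkage into $b$. Then there is no sequence $(D_n\mid n\in\mathbb{N})$ of exact hulls with $D_n\subsetneq D_{n+1}$ for all $n$ whose orders are bounded.
   Context: Paths are finite directed paths; "disjoint" means edge-disjoint. A finite set $S$ has a linkage into $b$ if there are pairwise edge-disjoint directed paths from each $s\in S$ to $b$. For $D\subseteq V(G)$, an edge is $D$-crossing if its start vertex is in $D$ and its end vertex is not; the order of $D$ is the number of $D$-crossing edges. $D$ is exact (for $I$ and $b$) if $b\notin D$ and the order of $D$ is finite and equal to $|D\cap I|$. $G$ is exact (for $b$ and $I$) if every $v\in V(G)\setminus\{b\}$ lies in some exact set. The hull $\hat D$ of $D$ is the set of vertices separated from $b$ by the set of $D$-crossing edges; an exact hull is an exact set that equals its own hull. -}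

module Defs where

open import Data.Nat using (ℕ; _≤_)
open import Data.List using (List; []; _∷_; _++_; length)
open import Data.List.Membership.Propositional using (_∈_)
open import Data.List.Relation.Unary.Unique.Propositional using (Unique)
open import Data.Product using (Σ; ∃; ∃-syntax; _×_; _,_)
open import Data.Empty using (⊥)
open import Relation.Nullary using (¬_)
open import Relation.Binary.PropositionalEquality using (_≡_; _≢_)
open import Function.Bundles using (_⇔_)

record Digraph : Set₁ where
  field
    V    : Set
    E    : Set
    tail : E → V
    head : E → V

Subset : Set → Set₁
Subset A = A → Set

HasSize : {A : Set} → Subset A → ℕ → Set
HasSize {A} P n =
  Σ (List A) λ xs → (length xs ≡ n) × Unique xs × (∀ x → (P x ⇔ (x ∈ xs)))

module _ (G : Digraph) where
  open Digraph G

  data Walk : V → V → Set where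
    []  : ∀ {v} → Walk v v
    _∷_ : ∀ {w} (e : E) → Walk (head e) w → Walk (tail e) w

  walkEdges : ∀ {u w} → Walk u w → List E
  walkEdges []       = []
  walkEdges (e ∷ p)  = e ∷ walkEdges p

  walkVertices : ∀ {u w} → Walk u w → List V
  walkVertices {u} []  = u ∷ []
  walkVertices (e ∷ p) = tail e ∷ walkVertices p

  Path : V → V → Set
  Path u w = Σ (Walk u w) λ p → Unique (walkVertices p)

  pathEdges : ∀ {u w} → Path u w → List E
  pathEdges (p , _) = walkEdges p

  EdgeDisjoint : ∀ {u u' w w'} → Path u w → Path u' w' → Set
  EdgeDisjoint p q = ∀ e → e ∈ pathEdges p → e ∈ pathEdges q → ⊥

  HasLinkage : List V → V → Set
  HasLinkage S b =
    Σ ((s : V) → s ∈ S → Path s b) λ P →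
      ∀ s s' (i : s ∈ S) (i' : s' ∈ S) → s ≢ s' → EdgeDisjoint (P s i) (P s' i')

  Crossing : Subset V → Subset E
  Crossing D e = D (tail e) × ¬ D (head e)

  HasOrder : Subset V → ℕ → Set
  HasOrder D k = HasSize (Crossing D) k

  Exact : Subset V → V → Subset V → Set
  Exact I b D = ¬ D b × ∃[ k ] (HasOrder D k × HasSize (λ v → D v × I v) k)

  GraphExact : V → Subset V → Set₁
  GraphExact b I = ∀ v → v ≢ b → Σ (Subset V) λ D → Exact I b D × D v

  Hull : V → Subset V → Subset V
  Hull b D v = ∀ (p : Path v b) → ∃[ e ] (e ∈ pathEdges p × Crossing D e)

  ExactHull : Subset V → V → Subset V → Set
  ExactHull I b D = Exact I b D × (∀ v → D v ⇔ Hull b D v)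

_⊊_ : {A : Set} → Subset A → Subset A → Set
P ⊊ Q = (∀ x → P x → Q x) × ∃ λ x → Q x × ¬ P x

-- Choose n with |D n ∩ I| maximal (possible up to double negation, since the orders
-- are bounded) and fix a linkage of D n ∩ I into b.  For j ≥ n every path of the
-- linkage starts in the hull D (j+1), so it uses a (j+1)-crossing edge; these edges
-- are distinct and already as many as the order of D (j+1), so every crossing edge
-- of D (j+1) lies on the linkage.  Hence if D (j+1) adds no vertex of the linkage to
-- D j, each crossing edge of D (j+1) also crosses D j, and D (j+1) ⊆ hull (D j) = D j.
-- So every step of the chain adds one of the finitely many linkage vertices: absurd.
module Submission where

open import Defs
open import Data.Nat using (ℕ; zero; suc; _≤_; _<_; _+_; _≤?_; z<s)
open import Data.Nat.Properties
  using (≤-trans; m≤m+n; +-suc; +-monoʳ-≤; ≰⇒>; <⇒≱; ≤-antisym; m<m+n; module ≤-Reasoning)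
open import Data.List.Properties using (++-identityʳ)
open import Data.List using (List; []; _∷_; _++_; length; concat)
open import Data.List.Membership.Propositional using (_∈_; mapWith∈)
open import Data.List.Membership.Propositional.Properties using (∈-concat⁺)
open import Data.List.Membership.Setoid.Properties using (length-mapWith∈)
open import Data.List.Relation.Binary.Subset.Propositional using (_⊆_)
open import Data.List.Relation.Binary.Subset.Propositional.Properties using (⊆-trans; ∷⁺ʳ; ⊆∷∧∉⇒⊆)
open import Data.List.Relation.Unary.Unique.Propositional.Properties using (Unique[x∷xs]⇒x∉xs)
open import Data.List.Relation.Unary.Any using (here; there)
open import Data.List.Relation.Unary.Any.Properties using (mapWith∈⁺; mapWith∈⁻)
import Data.List.Relation.Unary.All as All
open import Data.List.Relation.Unary.AllPairs using ([]; _∷_)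
open import Data.List.Relation.Unary.Unique.Propositional using (Unique)
open import Data.Product using (Σ; ∃-syntax; _×_; _,_; proj₁; proj₂; map₂)
open import Data.Empty using (⊥; ⊥-elim)
open import Function using (_∘_)
open import Relation.Nullary using (¬_; yes; no)
open import Relation.Nullary.Decidable using (decidable-stable; ¬¬-excluded-middle)
open import Relation.Binary.PropositionalEquality using (_≡_; _≢_; refl; sym; trans; cong; subst; setoid)
open import Function.Bundles using (Equivalence)
open Equivalence

module _ {A : Set} where

  ∈-delete : ∀ {y xs} → y ∈ xs → Σ (List A) λ xs' → (length xs ≡ suc (length xs') × xs ⊆ y ∷ xs')
  ∈-delete {xs = _ ∷ xs} (here refl) = xs , refl , λ x∈ → x∈
  ∈-delete {y} {x ∷ _} (there y∈) with xs' , len , ⊆y∷xs' ← ∈-delete y∈ =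
    x ∷ xs' , cong suc len , keep
    where
    keep : x ∷ _ ⊆ y ∷ x ∷ xs'
    keep (here refl) = there (here refl)
    keep (there z∈) with ⊆y∷xs' z∈
    ... | here refl   = here refl
    ... | there z∈xs' = there (there z∈xs')

  unique-⊆⇒complement : ∀ {ys xs : List A} → Unique ys → ys ⊆ xs →
    Σ (List A) λ zs → (length xs ≡ length ys + length zs × xs ⊆ ys ++ zs)
  unique-⊆⇒complement {[]} {xs} _ _ = xs , refl , λ x∈ → x∈
  unique-⊆⇒complement {y ∷ ys} uniqueY∷ys@(_ ∷ uniqueYs) y∷ys⊆xs
    with xs' , len , xs⊆y∷xs' ← ∈-delete (y∷ys⊆xs (here refl))
    with zs , len' , xs'⊆ ← unique-⊆⇒complement uniqueYs
           (⊆∷∧∉⇒⊆ (⊆-trans (y∷ys⊆xs ∘ there) xs⊆y∷xs') (Unique[x∷xs]⇒x∉xs uniqueY∷ys))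
    = zs , trans len (cong suc len') , ⊆-trans xs⊆y∷xs' (∷⁺ʳ y xs'⊆)

  unique-⊆⇒length-≤ : ∀ {ys xs : List A} → Unique ys → ys ⊆ xs → length ys ≤ length xs
  unique-⊆⇒length-≤ uniqueYs ys⊆xs with zs , len , _ ← unique-⊆⇒complement uniqueYs ys⊆xs =
    subst (_ ≤_) (sym len) (m≤m+n _ (length zs))

  unique-⊆-length-≥⇒⊇ : ∀ {ys xs : List A} → Unique ys → ys ⊆ xs →
    length xs ≤ length ys → xs ⊆ ys
  unique-⊆-length-≥⇒⊇ {ys} uniqueYs ys⊆xs xs≤ys with unique-⊆⇒complement uniqueYs ys⊆xs
  ... | [] , _ , xs⊆ys++[] = subst (_ ∈_) (++-identityʳ ys) ∘ xs⊆ys++[]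
  ... | _ ∷ _ , len , _ = ⊥-elim (<⇒≱ (subst (length ys <_) (sym len) (m<m+n (length ys) z<s)) xs≤ys)

  HasSize-unique : ∀ {P : Subset A} {m n} → HasSize P m → HasSize P n → m ≡ n
  HasSize-unique (xs , refl , uniqueXs , ∈xs) (ys , refl , uniqueYs , ∈ys) =
    ≤-antisym (unique-⊆⇒length-≤ uniqueXs λ {x} x∈ → to (∈ys x) (from (∈xs x) x∈))
              (unique-⊆⇒length-≤ uniqueYs λ {y} y∈ → to (∈xs y) (from (∈ys y) y∈))

  mapWith∈-unique : ∀ {B : Set} {xs : List A} (f : ∀ {x} → x ∈ xs → B) →
    (∀ {x y} (i : x ∈ xs) (j : y ∈ xs) → x ≢ y → f i ≢ f j) →
    Unique xs → Unique (mapWith∈ xs f)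
  mapWith∈-unique {xs = []} f _ [] = []
  mapWith∈-unique {xs = x ∷ xs} f f-separates (x∉xs ∷ uniqueXs) =
    All.tabulate head-fresh ∷ mapWith∈-unique (f ∘ there) (λ i j → f-separates (there i) (there j)) uniqueXs
    where
    head-fresh : ∀ {v} → v ∈ mapWith∈ xs (f ∘ there) → f (here refl) ≢ v
    head-fresh v∈ f-here≡v with y , j , v≡f-j ← mapWith∈⁻ xs (f ∘ there) v∈ =
      f-separates (here refl) (there j) (All.lookup x∉xs j) (trans f-here≡v v≡f-j)

  _⊆[_]_ : Subset A → List A → Subset A → Set
  Q ⊆[ W ] P = ∀ x → x ∈ W → Q x → P x

  ⊆[]-∷ : ∀ {Q P : Subset A} {y W} → (Q y → P y) → Q ⊆[ W ] P → Q ⊆[ y ∷ W ] P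
  ⊆[]-∷ Qy→Py _     _ (here refl)  = Qy→Py
  ⊆[]-∷ _     stall x (there x∈W) = stall x x∈W

  ascending-+ : {C : ℕ → Subset A} → (∀ i x → C i x → C (suc i) x) →
    ∀ k {i} x → C i x → C (k + i) x
  ascending-+ ascending zero    x x∈C = x∈C
  ascending-+ ascending (suc k) x x∈C = ascending _ x (ascending-+ ascending k x x∈C)

  -- Up to double negation, either y enters the chain at some level (and then
  -- stays) or never; in both cases it can be dropped from W.
  ascending-stalls-on-list : (C : ℕ → Subset A) → (∀ i x → C i x → C (suc i) x) →
    (W : List A) → ¬ (∀ i → ¬ (C (suc i) ⊆[ W ] C i))
  ascending-stalls-on-list C ascending [] grows = grows 0 λ _ ()
  ascending-stalls-on-list C ascending (y ∷ W) grows = ¬¬-excluded-middle {A = ∃[ i ] C i y} λ where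
    (yes (i , y∈C-i)) → ascending-stalls-on-list (λ k → C (k + i)) (λ k → ascending (k + i)) W
      λ k stall → grows (k + i) (⊆[]-∷ (λ _ → ascending-+ ascending k y y∈C-i) stall)
    (no never) → ascending-stalls-on-list C ascending W
      λ k stall → grows k (⊆[]-∷ (λ y∈C → ⊥-elim (never (suc k , y∈C))) stall)

¬¬-bounded-attains-max : (f : ℕ → ℕ) {K : ℕ} → (∀ n → f n ≤ K) → ¬ ¬ (∃[ n ] ∀ j → f j ≤ f n)
¬¬-bounded-attains-max f {K} f≤K no-max = no-max-within K 0 (m≤m+n K (f 0))
  where
  no-max-within : ∀ d n → K ≤ d + f n → ⊥
  no-max-within d n K≤d+fn =
    no-max (n , λ j → decidable-stable (f j ≤? f n) λ fj≰fn → exceeded d (≰⇒> fj≰fn) K≤d+fn)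
    where
    exceeded : ∀ d {j} → f n < f j → K ≤ d + f n → ⊥
    exceeded zero    {j} fn<fj K≤fn   = <⇒≱ fn<fj (≤-trans (f≤K j) K≤fn)
    exceeded (suc d) {j} fn<fj K≤d+1+fn = no-max-within d j (begin
      K               ≤⟨ K≤d+1+fn ⟩
      suc (d + f n)   ≡⟨ +-suc d (f n) ⟨
      d + suc (f n)   ≤⟨ +-monoʳ-≤ d fn<fj ⟩
      d + f j         ∎)
      where open ≤-Reasoning

module _ (G : Digraph) where
  open Digraph G

  tail-∈-walkVertices : ∀ {u w} (p : Walk G u w) {e} → e ∈ walkEdges G p → tail e ∈ walkVertices G p
  tail-∈-walkVertices (e ∷ p) (here refl) = here refl
  tail-∈-walkVertices (e ∷ p) (there e∈) = there (tail-∈-walkVertices p e∈)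

  linkageVertices : ∀ {S b} → ((s : V) → s ∈ S → Path G s b) → List V
  linkageVertices {S} P = concat (mapWith∈ S λ {s} s∈S → walkVertices G (proj₁ (P s s∈S)))

  ∈-linkageVertices : ∀ {S b} (P : (s : V) → s ∈ S → Path G s b) {s} (s∈S : s ∈ S) {v} →
    v ∈ walkVertices G (proj₁ (P s s∈S)) → v ∈ linkageVertices P
  ∈-linkageVertices P s∈S v∈ = ∈-concat⁺ (mapWith∈⁺ _ (_ , s∈S , v∈))

  Hull-transfer : ∀ {b C C'} → (∀ x → C x → C' x) → (∀ e → Crossing G C' e → C (tail e)) →
    ∀ v → Hull G b C' v → Hull G b C v
  Hull-transfer C⊆C' crossing-tails v v∈hull p with e , e∈p , (tail∈C' , head∉C') ← v∈hull p =
    e , e∈p , crossing-tails e (tail∈C' , head∉C') , head∉C' ∘ C⊆C' (head e)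

  -- Each path of the linkage contributes its own crossing edge, and these are
  -- pairwise distinct; if they already number the order, they are all of them.
  crossing-edge-on-linkage : ∀ {S b C k} → Unique S → (L : HasLinkage G S b) →
    (∀ s → s ∈ S → Hull G b C s) → HasOrder G C k → k ≤ length S →
    ∀ e → Crossing G C e → ∃[ s ] Σ (s ∈ S) λ s∈S → e ∈ pathEdges G (proj₁ L s s∈S)
  crossing-edge-on-linkage {S} {C = C} uniqueS (P , disjoint) S⊆hull
                           (crossing , refl , _ , ∈crossing) k≤|S| e e-crosses =
    map₂ (map₂ proj₁) (∈-picks⁻ (crossing⊆picks (to (∈crossing e) e-crosses)))
    where
    pick : ∀ {s} → s ∈ S → E
    pick {s} s∈S = proj₁ (S⊆hull s s∈S (P s s∈S))

    ∈-picks⁻ : ∀ {e} → e ∈ mapWith∈ S pick →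
      ∃[ s ] Σ (s ∈ S) λ s∈S → e ∈ pathEdges G (P s s∈S) × Crossing G C e
    ∈-picks⁻ e∈ with s , s∈S , refl ← mapWith∈⁻ S pick e∈ = s , s∈S , proj₂ (S⊆hull s s∈S (P s s∈S))

    picks⊆crossing : mapWith∈ S pick ⊆ crossing
    picks⊆crossing e∈ with _ , _ , _ , e-crosses ← ∈-picks⁻ e∈ = to (∈crossing _) e-crosses

    unique-picks : Unique (mapWith∈ S pick)
    unique-picks = mapWith∈-unique pick
      (λ {s} {s'} s∈S s'∈S s≢s' same → disjoint s s' s∈S s'∈S s≢s' (pick s∈S)
         (proj₁ (proj₂ (S⊆hull s s∈S (P s s∈S))))
         (subst (_∈ pathEdges G (P s' s'∈S)) (sym same) (proj₁ (proj₂ (S⊆hull s' s'∈S (P s' s'∈S))))))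
      uniqueS

    crossing⊆picks : crossing ⊆ mapWith∈ S pick
    crossing⊆picks = unique-⊆-length-≥⇒⊇ unique-picks picks⊆crossing
      (subst (length crossing ≤_) (sym (length-mapWith∈ (setoid V) S)) k≤|S|)

  ⊆-on-linkage⇒⊆ : ∀ {S b C C' k} → Unique S → (L : HasLinkage G S b) →
    (∀ x → C x → C' x) → (∀ x → Hull G b C x → C x) → (∀ x → C' x → Hull G b C' x) →
    (∀ s → s ∈ S → C' s) → HasOrder G C' k → k ≤ length S →
    C' ⊆[ linkageVertices (proj₁ L) ] C → ∀ z → C' z → C z
  ⊆-on-linkage⇒⊆ {C = C} {C'} uniqueS L C⊆C' Hull⊆C C'⊆Hull S⊆C' order k≤|S| stall z z∈C' =
    Hull⊆C z (Hull-transfer C⊆C' crossing-tails z (C'⊆Hull z z∈C'))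
    where
    crossing-tails : ∀ e → Crossing G C' e → C (tail e)
    crossing-tails e e-crosses@(tail∈C' , _)
      with s , s∈S , e∈path ← crossing-edge-on-linkage {C = C'} uniqueS L
                                (λ s → C'⊆Hull s ∘ S⊆C' s) order k≤|S| e e-crosses =
      stall (tail e) (∈-linkageVertices (proj₁ L) s∈S (tail-∈-walkVertices _ e∈path)) tail∈C'

lemma3p18 : (G : Digraph) (b : Digraph.V G) (I : Subset (Digraph.V G)) →
    (∀ v → I v → v ≢ b) →
    GraphExact G b I →
    (∀ (S : List (Digraph.V G)) → (∀ s → s ∈ S → I s) → HasLinkage G S b) →
    ¬ (Σ (ℕ → Subset (Digraph.V G)) λ D →
    (∀ n → ExactHull G I b (D n)) ×
    (∀ n → D n ⊊ D (suc n)) ×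
    (∃[ K ] ∀ n → ∃[ k ] (HasOrder G (D n) k × k ≤ K)))
lemma3p18 G b I _ _ linked (D , exactHull , strict , K , bounded) =
  ¬¬-bounded-attains-max order order≤K λ (n , maximal) →
    let (S , |S|≡ , uniqueS , ∈S) = inside n
        L = linked S (λ s → proj₂ ∘ from (∈S s))
    in ascending-stalls-on-list (λ i → D (i + n)) (λ i → ascending (i + n)) (linkageVertices G (proj₁ L))
         λ i stall → let (z , z∈ , z∉) = proj₂ (strict (i + n)) in
           z∉ (⊆-on-linkage⇒⊆ G uniqueS L (ascending (i + n))
                 (λ x → from (proj₂ (exactHull (i + n)) x)) (λ x → to (proj₂ (exactHull (suc i + n)) x))
                 (λ s → ascending-+ ascending (suc i) s ∘ proj₁ ∘ from (∈S s))
                 (hasOrder (suc i + n)) (subst (_ ≤_) (sym |S|≡) (maximal (suc i + n))) stall z z∈)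
  where
  order : ℕ → ℕ
  order n = proj₁ (proj₂ (proj₁ (exactHull n)))

  hasOrder : ∀ n → HasOrder G (D n) (order n)
  hasOrder n = proj₁ (proj₂ (proj₂ (proj₁ (exactHull n))))

  inside : ∀ n → HasSize (λ v → D n v × I v) (order n)
  inside n = proj₂ (proj₂ (proj₂ (proj₁ (exactHull n))))

  ascending : ∀ n x → D n x → D (suc n) x
  ascending n = proj₁ (strict n)

  order≤K : ∀ n → order n ≤ K
  order≤K n with k , k-order , k≤K ← bounded n = subst (_≤ K) (sym (HasSize-unique (hasOrder n) k-order)) k≤K
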